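{- Let $c\in\mathbb{N}$, and let $F$ be a double-fan on at least $8c^2+2c+1$ vertices with centres $v_1,v_2$. Let $\mathcal{P},\mathcal{Q}$ be partitions of $F$ such that $\mathcal{P}$ is a tree-partition and $|P\cap Q|\leq c$ for all $P\in\mathcal{P}$ and $Q\in\mathcal{Q}$. For each vertex $v_i$ let $P_i$ and $Q_i$ denote the parts of $\mathcal{P}$ and $\mathcal{Q}$ respectively containing $v_i$. If $P_1\neq P_2$ and $Q_1\neq Q_2$, then there exist vertices $v_3,v_4$ of $F$ such that $\{v_1,v_2,v_3,v_4\}$ is a $4$-clique and $Q_1,Q_2,Q_3,Q_4$ are pairwise distinct.
   Context: All graphs are finite, simple and undirected. A vertex is dominant if it is adjacent to every other vertex. A graph $F$ is a double-fan if $F$ has two dominant vertices $v$ and $w$, called the centres, such that $F-v-w$ is a path. A partition $\mathcal{P}$ of a graph $G$ is a partition of $V(G)$ into parts. $G/\mathcal{P}$ is the graph whose vertices are the non-empty parts of $\mathcal{P}$, with distinct parts $P_1,P_2$ adjacent iff some $v_1\in P_1$, $v_2\in P_2$ satisfy $v_1v_2\in E(G)$. $\mathcal{P}$ is a tree-partition if $G/\mathcal{P}$ is isomorphic to a subgraph of a tree. -}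

module Defs where

open import Data.Nat using (ℕ; zero; suc; _+_; _*_; _≤_)
open import Data.Fin using (Fin; toℕ; inject₁; fromℕ) renaming (zero to fzero; suc to fsuc)
open import Data.Fin.Properties using (_≟_)
open import Data.List using (List; length; filter; allFin)
open import Data.Product using (Σ; ∃; _×_; _,_; proj₁)
open import Data.Sum using (_⊎_)
open import Relation.Nullary using (¬_)
open import Relation.Nullary.Decidable using (_×-dec_)
open import Relation.Binary.PropositionalEquality using (_≡_; _≢_)
open import Function.Bundles using (_⇔_)

record SimpleGraph (V : Set) : Set₁ where
  field
    Adj    : V → V → Set
    sym    : ∀ {x y} → Adj x y → Adj y x
    irrefl : ∀ {x} → ¬ Adj x x
open SimpleGraph public

data Walk {V : Set} (G : SimpleGraph V) : V → V → Set where
  here : ∀ {x} → Walk G x x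
  step : ∀ {x y z} → Adj G x y → Walk G y z → Walk G x z

Connected : {V : Set} → SimpleGraph V → Set
Connected G = ∀ x y → Walk G x y

Cycle : {V : Set} → SimpleGraph V → Set
Cycle {V} G = Σ ℕ λ m → Σ (Fin (suc (suc (suc m))) → V) λ c →
  (∀ i j → c i ≡ c j → i ≡ j) ×
  (∀ (i : Fin (suc (suc m))) → Adj G (c (inject₁ i)) (c (fsuc i))) ×
  Adj G (c (fromℕ (suc (suc m)))) (c fzero)

Acyclic : {V : Set} → SimpleGraph V → Set
Acyclic G = ¬ Cycle G

IsTree : {k : ℕ} → SimpleGraph (Fin k) → Set
IsTree {k} T = (1 ≤ k) × Connected T × Acyclic T

Dominant : {V : Set} → SimpleGraph V → V → Set
Dominant G v = ∀ x → x ≢ v → Adj G v x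

-- F is a double-fan with centres v and w: v ≠ w, both dominant, and F - v - w is a
-- path, i.e. its vertices can be listed injectively as π 0, …, π (m-1) such that
-- π i and π j are adjacent iff |i - j| = 1.
IsDoubleFan : {n : ℕ} → SimpleGraph (Fin n) → Fin n → Fin n → Set
IsDoubleFan {n} F v w =
  v ≢ w × Dominant F v × Dominant F w ×
  (Σ ℕ λ m → Σ (Fin m → Fin n) λ π →
     (∀ i j → π i ≡ π j → i ≡ j) ×
     (∀ i → π i ≢ v × π i ≢ w) ×
     (∀ x → x ≢ v → x ≢ w → ∃ λ i → π i ≡ x) ×
     (∀ i j → Adj F (π i) (π j) ⇔ (toℕ j ≡ suc (toℕ i) ⊎ toℕ i ≡ suc (toℕ j))))

-- A partition of the vertex set Fin n, given by assigning to every vertex the label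
-- of its part (labels in Fin n suffice since there are at most n parts); the parts
-- are the non-empty fibres of the labelling.
Partition : ℕ → Set
Partition n = Fin n → Fin n

QVertex : {n : ℕ} → Partition n → Set
QVertex {n} P = Σ (Fin n) λ a → ∃ λ v → P v ≡ a

QAdj : {n : ℕ} → SimpleGraph (Fin n) → (P : Partition n) → QVertex P → QVertex P → Set
QAdj G P (a , _) (b , _) = a ≢ b × ∃ λ u → ∃ λ v → P u ≡ a × P v ≡ b × Adj G u v

quotientGraph : {n : ℕ} → SimpleGraph (Fin n) → (P : Partition n) → SimpleGraph (QVertex P)
quotientGraph G P = record
  { Adj = QAdj G P
  ; sym = λ { (a≢b , u , v , pu , pv , e) →
               (λ eq → a≢b (symm eq)) , v , u , pv , pu , SimpleGraph.sym G e }
  ; irrefl = λ { (a≢a , _) → a≢a Relation.Binary.PropositionalEquality.refl }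
  }
  where
  symm = Relation.Binary.PropositionalEquality.sym

-- P is a tree-partition: G/P is isomorphic to a subgraph of a tree, i.e. there is a
-- tree T and an injective map from the vertices of G/P to those of T preserving
-- adjacency.
IsTreePartition : {n : ℕ} → SimpleGraph (Fin n) → Partition n → Set₁
IsTreePartition G P =
  Σ ℕ λ k → Σ (SimpleGraph (Fin k)) λ T → IsTree T ×
  Σ (QVertex P → Fin k) λ φ →
    (∀ x y → φ x ≡ φ y → proj₁ x ≡ proj₁ y) ×
    (∀ x y → Adj (quotientGraph G P) x y → Adj T (φ x) (φ y))

interCard : {n : ℕ} → Partition n → Partition n → Fin n → Fin n → ℕ
interCard {n} P Q a b = length (filter (λ v → (P v ≟ a) ×-dec (Q v ≟ b)) (allFin n))

-- The centres are adjacent to every vertex and lie in different parts of the tree-partition, so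
-- a vertex in a third part would span a triangle in the quotient, which a tree does not have.
-- Hence every class of 𝒬 lies in P₁ ∪ P₂ and has at most 2c vertices.  Two consecutive vertices
-- of the rim path F − v₁ − v₂ lying outside Q₁ ∪ Q₂ and in different classes complete the centres
-- to the required 4-clique.  If there were no such pair, the rim vertices in Q₁ ∪ Q₂ would cut
-- the rim into monochromatic runs of at most 2c vertices each; as Q₁ and Q₂ already contain a
-- centre, the rim meets them in at most 4c − 2 vertices, so F would have at most
-- (4c − 2)(2c + 1) + 2c + 2 = 8c² + 2c vertices.
module Submission where

open import Defs
open import Data.Nat using (ℕ; zero; suc; _+_; _*_; _≤_; z≤n; s≤s)
open import Data.Nat.Properties hiding (_≟_)
open import Data.Nat.Solver using (module +-*-Solver)
open +-*-Solver using (solve; _:+_; _:*_; _:=_; con)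
open import Data.Fin using (Fin; toℕ; inject₁) renaming (zero to fzero; suc to fsuc)
open import Data.Fin.Properties using (_≟_)
open import Data.List using (List; []; _∷_; _++_; length; filter; allFin; tabulate)
open import Data.List.Properties using (length-++; length-tabulate; filter-accept)
open import Data.List.Membership.Propositional.Properties
  using (∈-∃++; ∈-++⁻; ∈-++⁺ˡ; ∈-++⁺ʳ; ∈-tabulate⁺; ∈-allFin)
open import Data.List.Relation.Binary.Subset.Propositional using (_⊆_)
open import Data.List.Relation.Binary.Subset.Propositional.Properties using (filter⁺′)
open import Data.List.Relation.Unary.Any using (here; there)
open import Data.List.Relation.Unary.All using (All; _∷_) renaming (lookup to All-lookup)
open import Data.List.Relation.Unary.All.Properties using ()
  renaming (tabulate⁺ to All-tabulate⁺)
open import Data.List.Relation.Unary.AllPairs using (_∷_)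
open import Data.List.Relation.Unary.Linked using (Linked; []; [-]; _∷_)
open import Data.List.Relation.Unary.Unique.Propositional using (Unique)
open import Data.List.Relation.Unary.Unique.Propositional.Properties
  using (allFin⁺) renaming (filter⁺ to Unique-filter⁺; tabulate⁺ to Unique-tabulate⁺)
open import Data.Product using (∃; ∃₂; _×_; _,_; proj₁; proj₂)
open import Data.Sum using (_⊎_; inj₁; inj₂; [_,_])
open import Data.Empty using (⊥; ⊥-elim)
open import Function using (_∘_; id; case_of_)
open import Function.Bundles using (Equivalence)
open import Level using (0ℓ)
open import Relation.Binary using (Rel; DecidableEquality)
open import Relation.Binary.PropositionalEquality using (_≡_; _≢_; refl; cong)
  renaming (sym to ≡-sym)
open import Relation.Nullary using (¬_; Dec; yes; no)
open import Relation.Nullary.Decidable using (_×-dec_; _⊎-dec_)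
open import Relation.Unary using (Pred; Decidable)

module _ {A : Set} where

  Unique-⊆⇒length≤ : {xs ys : List A} → Unique xs → xs ⊆ ys → length xs ≤ length ys
  Unique-⊆⇒length≤ {[]} _ _ = z≤n
  Unique-⊆⇒length≤ {x ∷ xs} (x∉xs ∷ xs!) xs⊆ys with ∈-∃++ (xs⊆ys (here refl))
  ... | ys₁ , ys₂ , refl = begin
    suc (length xs)               ≤⟨ s≤s (Unique-⊆⇒length≤ xs! xs⊆ys₁++ys₂) ⟩
    suc (length (ys₁ ++ ys₂))     ≡⟨ cong suc (length-++ ys₁) ⟩
    suc (length ys₁ + length ys₂) ≡⟨ ≡-sym (+-suc (length ys₁) (length ys₂)) ⟩
    length ys₁ + length (x ∷ ys₂) ≡⟨ ≡-sym (length-++ ys₁) ⟩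
    length (ys₁ ++ x ∷ ys₂)       ∎
    where
    open ≤-Reasoning
    xs⊆ys₁++ys₂ : xs ⊆ ys₁ ++ ys₂
    xs⊆ys₁++ys₂ {z} z∈xs with ∈-++⁻ ys₁ (xs⊆ys (there z∈xs))
    ... | inj₁ z∈ys₁ = ∈-++⁺ˡ z∈ys₁
    ... | inj₂ (here refl) = ⊥-elim (All-lookup x∉xs z∈xs refl)
    ... | inj₂ (there z∈ys₂) = ∈-++⁺ʳ ys₁ z∈ys₂

  count : {P : Pred A 0ℓ} → Decidable P → List A → ℕ
  count P? xs = length (filter P? xs)

  count-≤-∷ : {P : Pred A 0ℓ} (P? : Decidable P) → ∀ x xs →
    count P? xs ≤ count P? (x ∷ xs)
  count-≤-∷ P? x xs with P? x
  ... | yes _ = n≤1+n _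
  ... | no _ = ≤-refl

  count-accept : {P : Pred A 0ℓ} (P? : Decidable P) {x : A} {xs : List A} → P x →
    count P? (x ∷ xs) ≡ suc (count P? xs)
  count-accept P? px = cong length (filter-accept P? px)

  count-mono-⊆ : {P : Pred A 0ℓ} (P? : Decidable P) {xs ys : List A} → Unique xs → xs ⊆ ys →
    count P? xs ≤ count P? ys
  count-mono-⊆ P? xs! xs⊆ys =
    Unique-⊆⇒length≤ (Unique-filter⁺ P? xs!) (filter⁺′ P? P? id xs⊆ys)

  count-≤-+ : {P Q R : Pred A 0ℓ} (P? : Decidable P) (Q? : Decidable Q) (R? : Decidable R) →
    (∀ {x} → P x → Q x ⊎ R x) → ∀ xs → count P? xs ≤ count Q? xs + count R? xs
  count-≤-+ P? Q? R? cover [] = z≤n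
  count-≤-+ P? Q? R? cover (x ∷ xs) with P? x
  ... | no _ = ≤-trans (count-≤-+ P? Q? R? cover xs)
                       (+-mono-≤ (count-≤-∷ Q? x xs) (count-≤-∷ R? x xs))
  ... | yes px with cover px
  ...   | inj₁ qx = begin
    suc (count P? xs)                      ≤⟨ s≤s (count-≤-+ P? Q? R? cover xs) ⟩
    suc (count Q? xs + count R? xs)        ≤⟨ s≤s (+-monoʳ-≤ _ (count-≤-∷ R? x xs)) ⟩
    suc (count Q? xs) + count R? (x ∷ xs)  ≡⟨ cong (_+ _) (≡-sym (count-accept Q? qx)) ⟩
    count Q? (x ∷ xs) + count R? (x ∷ xs)  ∎
    where open ≤-Reasoning
  ...   | inj₂ rx = begin
    suc (count P? xs)                      ≤⟨ s≤s (count-≤-+ P? Q? R? cover xs) ⟩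
    suc (count Q? xs + count R? xs)        ≡⟨ ≡-sym (+-suc (count Q? xs) (count R? xs)) ⟩
    count Q? xs + suc (count R? xs)        ≤⟨ +-monoˡ-≤ _ (count-≤-∷ Q? x xs) ⟩
    count Q? (x ∷ xs) + suc (count R? xs)  ≡⟨ cong (_ +_) (≡-sym (count-accept R? rx)) ⟩
    count Q? (x ∷ xs) + count R? (x ∷ xs)  ∎
    where open ≤-Reasoning

module _ {A C : Set} (_≟ᶜ_ : DecidableEquality C) (colour : A → C) where

  hasColour? : (c : C) → Decidable (λ x → colour x ≡ c)
  hasColour? c x = colour x ≟ᶜ c

  colourCount : C → List A → ℕ
  colourCount c = count (hasColour? c)

  module _ {S : Pred A 0ℓ} (S? : Decidable S) where

    Joined : Rel A 0ℓ
    Joined x y = S x ⊎ S y ⊎ colour x ≡ colour y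

    joined? : ∀ x y → Dec (Joined x y)
    joined? x y = S? x ⊎-dec (S? y ⊎-dec (colour x ≟ᶜ colour y))

    module _ (K : ℕ) where

      -- Dominates the initial run of x ∷ xs outside S, which Joined makes monochromatic.
      slack : A → List A → ℕ
      slack x xs with S? x
      ... | yes _ = 0
      ... | no _ = colourCount (colour x) (x ∷ xs)

      slack≤ : ∀ x xs → (∀ c → colourCount c (x ∷ xs) ≤ K) → slack x xs ≤ K
      slack≤ x xs bounded with S? x
      ... | yes _ = z≤n
      ... | no _ = bounded (colour x)

      colourCount-≤-∷ : ∀ x xs → (∀ c → colourCount c (x ∷ xs) ≤ K) →
        ∀ c → colourCount c xs ≤ K
      colourCount-≤-∷ x xs bounded c = ≤-trans (count-≤-∷ (hasColour? c) x xs) (bounded c)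

      ∷-Linked-length≤ : ∀ x xs → Linked Joined (x ∷ xs) →
        (∀ c → colourCount c (x ∷ xs) ≤ K) →
        length (x ∷ xs) ≤ suc K * count S? (x ∷ xs) + slack x xs
      ∷-Linked-length≤ x [] [-] bounded with S? x
      ... | yes _ = s≤s z≤n
      ... | no _ =
        ≤-trans (≤-reflexive (≡-sym (count-accept (hasColour? (colour x)) refl))) (m≤n+m _ _)
      ∷-Linked-length≤ x (y ∷ ys) (xy ∷ linked) bounded with S? x
      ... | yes _ = begin
        suc (length (y ∷ ys))   ≤⟨ s≤s (≤-trans ih (+-monoʳ-≤ _ (slack≤ y ys bounded′))) ⟩
        suc (suc K * s + K)     ≡⟨ solve 2 (λ K s → con 1 :+ ((con 1 :+ K) :* s :+ K)
                                             := (con 1 :+ K) :* (con 1 :+ s) :+ con 0) refl K s ⟩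
        suc K * suc s + 0       ∎
        where
        open ≤-Reasoning
        s = count S? (y ∷ ys)
        bounded′ = colourCount-≤-∷ x (y ∷ ys) bounded
        ih = ∷-Linked-length≤ y ys linked bounded′
      ... | no ¬sx
        with S? y | ∷-Linked-length≤ y ys linked (colourCount-≤-∷ x (y ∷ ys) bounded)
      ...   | yes _ | ih = begin
        suc (length (y ∷ ys))   ≤⟨ s≤s ih ⟩
        suc (suc K * s + 0)     ≡⟨ ≡-sym (+-suc (suc K * s) 0) ⟩
        suc K * s + 1           ≤⟨ +-monoʳ-≤ _ (≤-trans (s≤s z≤n) (≤-reflexive x-counted)) ⟩
        suc K * s + colourCount (colour x) (x ∷ y ∷ ys) ∎
        where
        open ≤-Reasoning
        s = suc (count S? ys)
        x-counted = ≡-sym (count-accept (hasColour? (colour x)) refl)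
      ...   | no ¬sy | ih = begin
        suc (length (y ∷ ys))                            ≤⟨ s≤s ih ⟩
        suc (suc K * s + colourCount (colour y) (y ∷ ys)) ≡⟨ ≡-sym (+-suc (suc K * s) _) ⟩
        suc K * s + suc (colourCount (colour y) (y ∷ ys)) ≡⟨ cong (suc K * s +_) x-counted ⟩
        suc K * s + colourCount (colour y) (x ∷ y ∷ ys)
          ≡⟨ cong (λ c → suc K * s + colourCount c (x ∷ y ∷ ys)) (≡-sym x~y) ⟩
        suc K * s + colourCount (colour x) (x ∷ y ∷ ys)   ∎
        where
        open ≤-Reasoning
        s = count S? ys
        x~y : colour x ≡ colour y
        x~y = [ ⊥-elim ∘ ¬sx , [ ⊥-elim ∘ ¬sy , id ] ] xy
        x-counted = ≡-sym (count-accept (hasColour? (colour y)) x~y)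

      Linked-length≤ : ∀ xs → Linked Joined xs → (∀ c → colourCount c xs ≤ K) →
        length xs ≤ suc K * count S? xs + K
      Linked-length≤ [] _ _ = z≤n
      Linked-length≤ (x ∷ xs) linked bounded =
        ≤-trans (∷-Linked-length≤ x xs linked bounded) (+-monoʳ-≤ _ (slack≤ x xs bounded))

tabulate-Linked⊎gap : {A : Set} {R : Rel A 0ℓ} → (∀ x y → Dec (R x y)) →
  ∀ {m} (f : Fin m → A) →
  Linked R (tabulate f) ⊎ ∃₂ λ i j → toℕ j ≡ suc (toℕ i) × ¬ R (f i) (f j)
tabulate-Linked⊎gap R? {zero} f = inj₁ []
tabulate-Linked⊎gap R? {suc zero} f = inj₁ [-]
tabulate-Linked⊎gap R? {suc (suc m)} f
  with R? (f fzero) (f (fsuc fzero)) | tabulate-Linked⊎gap R? (f ∘ fsuc)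
... | no ¬r | _ = inj₂ (fzero , fsuc fzero , refl , ¬r)
... | yes _ | inj₂ (i , j , j≡1+i , ¬r) = inj₂ (fsuc i , fsuc j , cong suc j≡1+i , ¬r)
... | yes r | inj₁ linked = inj₁ (r ∷ linked)

acyclic⇒triangle-free : {V : Set} (T : SimpleGraph V) → Acyclic T →
  ∀ {a b c} → Adj T a b → Adj T b c → Adj T c a → ⊥
acyclic⇒triangle-free T acyclic {a} {b} {c} ab bc ca =
  acyclic (0 , triangle , injective , edges , ca)
  where
  triangle : Fin 3 → _
  triangle fzero = a
  triangle (fsuc fzero) = b
  triangle (fsuc (fsuc fzero)) = c
  distinct : ∀ {x y} → Adj T x y → x ≢ y
  distinct xy refl = irrefl T xy
  injective : ∀ i j → triangle i ≡ triangle j → i ≡ j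
  injective fzero fzero _ = refl
  injective fzero (fsuc fzero) = ⊥-elim ∘ distinct ab
  injective fzero (fsuc (fsuc fzero)) = ⊥-elim ∘ distinct (SimpleGraph.sym T ca)
  injective (fsuc fzero) fzero = ⊥-elim ∘ distinct (SimpleGraph.sym T ab)
  injective (fsuc fzero) (fsuc fzero) _ = refl
  injective (fsuc fzero) (fsuc (fsuc fzero)) = ⊥-elim ∘ distinct bc
  injective (fsuc (fsuc fzero)) fzero = ⊥-elim ∘ distinct ca
  injective (fsuc (fsuc fzero)) (fsuc fzero) = ⊥-elim ∘ distinct (SimpleGraph.sym T bc)
  injective (fsuc (fsuc fzero)) (fsuc (fsuc fzero)) _ = refl
  edges : ∀ (i : Fin 2) → Adj T (triangle (inject₁ i)) (triangle (fsuc i))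
  edges fzero = ab
  edges (fsuc fzero) = bc

module _ {n : ℕ} (G : SimpleGraph (Fin n)) (P : Partition n) where

  IsTreePartition⇒triangle-free : IsTreePartition G P → ∀ {u v w} →
    Adj G u v → Adj G v w → Adj G w u → P u ≢ P v → P v ≢ P w → P w ≢ P u → ⊥
  IsTreePartition⇒triangle-free (_ , T , (_ , _ , acyclic) , φ , _ , φ-adj)
                                uv vw wu Pu≢Pv Pv≢Pw Pw≢Pu =
    acyclic⇒triangle-free T acyclic (lift uv Pu≢Pv) (lift vw Pv≢Pw) (lift wu Pw≢Pu)
    where
    part : Fin n → QVertex P
    part x = P x , x , refl
    lift : ∀ {x y} → Adj G x y → P x ≢ P y → Adj T (φ (part x)) (φ (part y))
    lift {x} {y} xy Px≢Py = φ-adj (part x) (part y) (Px≢Py , x , y , refl , refl , xy)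

  dominant-parts-cover : IsTreePartition G P → ∀ {v₁ v₂} → Dominant G v₁ → Dominant G v₂ →
    v₁ ≢ v₂ → P v₁ ≢ P v₂ → ∀ x → P x ≡ P v₁ ⊎ P x ≡ P v₂
  dominant-parts-cover tree {v₁} {v₂} dom₁ dom₂ v₁≢v₂ P₁≢P₂ x
    with P x ≟ P v₁ | P x ≟ P v₂
  ... | yes x∈P₁ | _ = inj₁ x∈P₁
  ... | no _ | yes x∈P₂ = inj₂ x∈P₂
  ... | no x∉P₁ | no x∉P₂ = ⊥-elim (IsTreePartition⇒triangle-free tree
    (dom₁ v₂ (v₁≢v₂ ∘ ≡-sym)) (dom₂ x (x∉P₂ ∘ cong P))
    (SimpleGraph.sym G (dom₁ x (x∉P₁ ∘ cong P)))
    P₁≢P₂ (x∉P₂ ∘ ≡-sym) x∉P₁)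

class-size≤ : {n c : ℕ} (P Q : Partition n) {p₁ p₂ : Fin n} →
  (∀ x → P x ≡ p₁ ⊎ P x ≡ p₂) →
  (∀ a b → interCard P Q a b ≤ c) → ∀ b → colourCount _≟_ Q b (allFin n) ≤ c + c
class-size≤ {n} P Q {p₁} {p₂} cover inter b =
  ≤-trans (count-≤-+ (hasColour? _≟_ Q b) (in-part p₁) (in-part p₂) split (allFin n))
          (+-mono-≤ (inter p₁ b) (inter p₂ b))
  where
  in-part : (p : Fin n) → Decidable (λ v → P v ≡ p × Q v ≡ b)
  in-part p v = (P v ≟ p) ×-dec (Q v ≟ b)
  split : ∀ {v} → Q v ≡ b → (P v ≡ p₁ × Q v ≡ b) ⊎ (P v ≡ p₂ × Q v ≡ b)
  split {v} Qv≡b = [ inj₁ ∘ (_, Qv≡b) , inj₂ ∘ (_, Qv≡b) ] (cover v)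

fan-arithmetic : ∀ K s m → m ≤ suc K * s + K → 2 + s ≤ K + K → 2 + m ≤ K * suc (K + K)
fan-arithmetic K s m m≤ s≤ = +-cancelʳ-≤ K _ _ (begin
  2 + m + K                ≤⟨ +-monoˡ-≤ K (s≤s (s≤s m≤)) ⟩
  2 + (suc K * s + K) + K  ≡⟨ solve 2 (λ K s → con 2 :+ ((con 1 :+ K) :* s :+ K) :+ K
                                         := (con 1 :+ K) :* (con 2 :+ s)) refl K s ⟩
  suc K * (2 + s)          ≤⟨ *-monoʳ-≤ (suc K) s≤ ⟩
  suc K * (K + K)          ≡⟨ solve 1 (λ K → (con 1 :+ K) :* (K :+ K)
                                         := K :* (con 1 :+ (K :+ K)) :+ K) refl K ⟩
  K * suc (K + K) + K      ∎)
  where open ≤-Reasoning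

module _ {n : ℕ} (Q : Partition n) (v₁ v₂ : Fin n) where

  InCentreClass : Pred (Fin n) 0ℓ
  InCentreClass x = Q x ≡ Q v₁ ⊎ Q x ≡ Q v₂

  inCentreClass? : Decidable InCentreClass
  inCentreClass? x = (Q x ≟ Q v₁) ⊎-dec (Q x ≟ Q v₂)

  RimJoined : Rel (Fin n) 0ℓ
  RimJoined = Joined _≟_ Q inCentreClass?

  ¬RimJoined⇒distinct : Q v₁ ≢ Q v₂ → ∀ {x y} → ¬ RimJoined x y →
    Q v₁ ≢ Q v₂ × Q v₁ ≢ Q x × Q v₁ ≢ Q y × Q v₂ ≢ Q x × Q v₂ ≢ Q y × Q x ≢ Q y
  ¬RimJoined⇒distinct Q₁≢Q₂ ¬joined =
    Q₁≢Q₂ , ¬joined ∘ inj₁ ∘ inj₁ ∘ ≡-sym , ¬joined ∘ inj₂ ∘ inj₁ ∘ inj₁ ∘ ≡-sym ,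
    ¬joined ∘ inj₁ ∘ inj₂ ∘ ≡-sym , ¬joined ∘ inj₂ ∘ inj₁ ∘ inj₂ ∘ ≡-sym , ¬joined ∘ inj₂ ∘ inj₂

  Linked-rim-length≤ : ∀ {K} → (∀ b → colourCount _≟_ Q b (allFin n) ≤ K) →
    ∀ xs → Unique (v₁ ∷ v₂ ∷ xs) → Linked RimJoined xs → 2 + length xs ≤ K * suc (K + K)
  Linked-rim-length≤ {K} class-size xs ((_ ∷ v₁∉xs) ∷ v₂∉xs ∷ xs!) linked =
    fan-arithmetic K (count inCentreClass? xs) (length xs)
      (Linked-length≤ _≟_ Q inCentreClass? K xs linked
        (λ b → ≤-trans (count-mono-⊆ (hasColour? _≟_ Q b) xs! ⊆allFin) (class-size b)))
      (begin
        2 + count inCentreClass? xs    ≤⟨ s≤s (s≤s centre-classes) ⟩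
        2 + (hits v₁ + hits v₂)        ≡⟨ cong suc (≡-sym (+-suc (hits v₁) (hits v₂))) ⟩
        suc (hits v₁) + suc (hits v₂)  ≤⟨ +-mono-≤ (centre-hits v₁∉xs) (centre-hits v₂∉xs) ⟩
        K + K                          ∎)
    where
    open ≤-Reasoning
    ⊆allFin : ∀ {ys} → ys ⊆ allFin n
    ⊆allFin {_} {z} _ = ∈-allFin z
    classOf? : (v : Fin n) → Decidable (λ x → Q x ≡ Q v)
    classOf? v = hasColour? _≟_ Q (Q v)
    hits : Fin n → ℕ
    hits v = count (classOf? v) xs
    centre-classes : count inCentreClass? xs ≤ hits v₁ + hits v₂
    centre-classes = count-≤-+ inCentreClass? (classOf? v₁) (classOf? v₂) id xs
    centre-hits : ∀ {v} → All (v ≢_) xs → suc (hits v) ≤ K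
    centre-hits {v} v∉xs = begin
      suc (hits v)                    ≡⟨ ≡-sym (count-accept (classOf? v) refl) ⟩
      count (classOf? v) (v ∷ xs)     ≤⟨ count-mono-⊆ (classOf? v) (v∉xs ∷ xs!) ⊆allFin ⟩
      count (classOf? v) (allFin n)   ≤⟨ class-size (Q v) ⟩
      K                               ∎

module DoubleFan {n : ℕ} (F : SimpleGraph (Fin n)) (v₁ v₂ : Fin n) where

  rim : IsDoubleFan F v₁ v₂ → List (Fin n)
  rim (_ , _ , _ , _ , π , _) = tabulate π

  rim-unique : (fan : IsDoubleFan F v₁ v₂) → Unique (v₁ ∷ v₂ ∷ rim fan)
  rim-unique (v₁≢v₂ , _ , _ , _ , π , π-injective , π-avoids , _) =
    (v₁≢v₂ ∷ All-tabulate⁺ (λ i → proj₁ (π-avoids i) ∘ ≡-sym))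
    ∷ All-tabulate⁺ (λ i → proj₂ (π-avoids i) ∘ ≡-sym)
    ∷ Unique-tabulate⁺ (π-injective _ _)

  allFin⊆centres∷rim : (fan : IsDoubleFan F v₁ v₂) → allFin n ⊆ v₁ ∷ v₂ ∷ rim fan
  allFin⊆centres∷rim (_ , _ , _ , _ , π , _ , _ , π-onto , _) {z} _
    with z ≟ v₁ | z ≟ v₂
  ... | yes z≡v₁ | _ = here z≡v₁
  ... | no _ | yes z≡v₂ = there (here z≡v₂)
  ... | no z≢v₁ | no z≢v₂ with π-onto z z≢v₁ z≢v₂
  ...   | i , refl = there (there (∈-tabulate⁺ i))

  doubleFan-size≤ : (fan : IsDoubleFan F v₁ v₂) → n ≤ 2 + length (rim fan)
  doubleFan-size≤ fan = begin
    n                     ≡⟨ ≡-sym (length-tabulate id) ⟩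
    length (allFin n)     ≤⟨ Unique-⊆⇒length≤ (allFin⁺ n) (allFin⊆centres∷rim fan) ⟩
    2 + length (rim fan)  ∎
    where open ≤-Reasoning

  rim-Linked⊎K₄ : {R : Rel (Fin n) 0ℓ} → (∀ x y → Dec (R x y)) →
    (fan : IsDoubleFan F v₁ v₂) →
    Linked R (rim fan) ⊎ ∃₂ λ x y → ¬ R x y ×
      (Adj F v₁ v₂ × Adj F v₁ x × Adj F v₁ y × Adj F v₂ x × Adj F v₂ y × Adj F x y)
  rim-Linked⊎K₄ R? (v₁≢v₂ , dom₁ , dom₂ , _ , π , _ , π-avoids , _ , π-adj)
    with tabulate-Linked⊎gap R? π
  ... | inj₁ linked = inj₁ linked
  ... | inj₂ (i , j , j≡1+i , ¬r) = inj₂ (π i , π j , ¬r ,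
    dom₁ v₂ (v₁≢v₂ ∘ ≡-sym) ,
    dom₁ (π i) (proj₁ (π-avoids i)) , dom₁ (π j) (proj₁ (π-avoids j)) ,
    dom₂ (π i) (proj₂ (π-avoids i)) , dom₂ (π j) (proj₂ (π-avoids j)) ,
    Equivalence.from (π-adj i j) (inj₁ j≡1+i))

lemma11 : (c n : ℕ) → (F : SimpleGraph (Fin n)) → (v₁ v₂ : Fin n) →
  IsDoubleFan F v₁ v₂ → 8 * (c * c) + 2 * c + 1 ≤ n →
  (P Q : Partition n) → IsTreePartition F P →
  (∀ a b → interCard P Q a b ≤ c) →
  P v₁ ≢ P v₂ → Q v₁ ≢ Q v₂ →
  ∃ λ v₃ → ∃ λ v₄ →
    (Adj F v₁ v₂ × Adj F v₁ v₃ × Adj F v₁ v₄ × Adj F v₂ v₃ × Adj F v₂ v₄ × Adj F v₃ v₄) ×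
    (Q v₁ ≢ Q v₂ × Q v₁ ≢ Q v₃ × Q v₁ ≢ Q v₄ × Q v₂ ≢ Q v₃ × Q v₂ ≢ Q v₄ × Q v₃ ≢ Q v₄)
lemma11 c n F v₁ v₂ fan@(v₁≢v₂ , dom₁ , dom₂ , _) large P Q tree inter P₁≢P₂ Q₁≢Q₂ =
  case rim-Linked⊎K₄ (joined? _≟_ Q (inCentreClass? Q v₁ v₂)) fan of λ where
    (inj₂ (x , y , ¬joined , clique)) →
      x , y , clique , ¬RimJoined⇒distinct Q v₁ v₂ Q₁≢Q₂ ¬joined
    (inj₁ linked) →
      ⊥-elim (≤⇒≯ (n≤8c²+2c linked) (≤-trans (≤-reflexive (+-comm 1 _)) large))
  where
  open DoubleFan F v₁ v₂
  open ≤-Reasoning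
  class-size : ∀ b → colourCount _≟_ Q b (allFin n) ≤ c + c
  class-size = class-size≤ P Q (dominant-parts-cover F P tree dom₁ dom₂ v₁≢v₂ P₁≢P₂) inter
  n≤8c²+2c : Linked (RimJoined Q v₁ v₂) (rim fan) → n ≤ 8 * (c * c) + 2 * c
  n≤8c²+2c linked = begin
    n                          ≤⟨ doubleFan-size≤ fan ⟩
    2 + length (rim fan)       ≤⟨ Linked-rim-length≤ Q v₁ v₂ class-size _ (rim-unique fan) linked ⟩
    (c + c) * suc (c + c + (c + c))
      ≡⟨ solve 1 (λ c → (c :+ c) :* (con 1 :+ (c :+ c :+ (c :+ c)))
                      := con 8 :* (c :* c) :+ con 2 :* c) refl c ⟩
    8 * (c * c) + 2 * c        ∎
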